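{- Let $p \geq 3$ be a prime number, let $\alpha', \beta'$ be odd integers and $\gamma$ an integer, and let $q(n) = \frac{\alpha'}{2} n^2 + \frac{\beta'}{2} n + \gamma$ for $n \geq 0$ (an integer for every integer $n$). Suppose at least one of the following holds: (1) $p \nmid \alpha'$; (2) $p \mid \beta'$; (3) $\alpha' = p^k c$ for some integer $k \geq 0$ and some integer $c$ with $p \nmid c$ and $c \nmid \beta'$. Then there exists an integer $n > 0$ such that $D_q(n) \neq p^{\lceil \log_p n \rceil}$.
   Context: For an integer sequence $s = (s(i))_{i \geq 0}$ and an integer $n \geq 1$, the discriminator $D_s(n)$ is the least positive integer $m$ such that $s(0), \ldots, s(n-1)$ are pairwise incongruent modulo $m$. If two of $s(0), \ldots, s(n-1)$ are equal, no such $m$ exists, and then $D_s(n) \neq p^{\lceil \log_p n \rceil}$ is understood to hold. -}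

module Defs where

open import Data.Nat as ℕ using (ℕ; zero; suc; _^_; _≤ᵇ_)
open import Data.Bool using (if_then_else_)
open import Data.Integer as ℤ using (ℤ; +_; _-_; _*_; _+_)
open import Data.Integer.DivMod using (_/_)
open import Data.Integer.Divisibility using (_∣_)
open import Data.Product using (_×_)
open import Relation.Nullary using (¬_)
open import Relation.Binary.PropositionalEquality using (_≡_)

-- q(n) = α'/2 n² + β'/2 n + γ, computed as (α' n² + β' n)/2 + γ
-- (the division is exact when α', β' are odd).
quadSeq : ℤ → ℤ → ℤ → ℕ → ℤ
quadSeq α β γ n = ((α * (+ n) * (+ n) + β * (+ n)) / (+ 2)) + γ

Discriminates : (ℕ → ℤ) → ℕ → ℕ → Set
Discriminates s n m =
  ∀ i j → i ℕ.< n → j ℕ.< n → ¬ (i ≡ j) → ¬ ((+ m) ∣ (s i - s j))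

-- D_s(n) = t : t is the least positive integer m with Discriminates s n m.
-- If no such m exists (e.g. two of the values coincide), IsDiscriminator s n t
-- is false for every t, so D_s(n) ≠ t holds, as in the paper's convention.
IsDiscriminator : (ℕ → ℤ) → ℕ → ℕ → Set
IsDiscriminator s n t =
  (0 ℕ.< t) × Discriminates s n t × (∀ m → 0 ℕ.< m → m ℕ.< t → ¬ Discriminates s n m)

-- ⌈log_p n⌉ : least k with n ≤ p^k (searched up to k = n, enough for p ≥ 2)
ceilLogGo : ℕ → ℕ → ℕ → ℕ → ℕ
ceilLogGo p n k zero = k
ceilLogGo p n k (suc f) = if n ≤ᵇ p ^ k then k else ceilLogGo p n (suc k) f

⌈log_⌉_ : ℕ → ℕ → ℕ
⌈log p ⌉ n = ceilLogGo p n 0 n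

{-# OPTIONS --safe #-}
-- For odd α′, β′ we have 2(q(i) − q(j)) = (i − j)(α′(i + j) + β′), so the odd prime p divides
-- q(i) − q(j) exactly when it divides one of the two factors.
-- If p ∤ α′, the congruence α′x + β′ ≡ 0 has a root mod p, which yields i ≠ j < p with
-- p ∣ q(i) − q(j); hence D(p) ≠ p. If p divides α′ and β′, then p ∣ q(1) − q(0) and D(2) ≠ p.
-- If p ∣ α′ but p ∤ β′, either p − 1 already separates q(0), q(1), so D(2) ≤ p − 1, or
-- p − 1 ∣ q(1) − q(0). In the latter case p ∣ q(i) − q(j) with j < i ≤ p forces (i, j) = (p, 0),
-- and p(p − 1) ∣ q(p) − q(0) would make α′ even; so p(p − 1) < p² separates q(0), …, q(p)
-- and D(p + 1) ≠ p².
module Submission where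

open import Defs
open import Data.Nat as ℕ using (ℕ; zero; suc; _^_; _≤_; _<_; _∸_; z≤n; s≤s; z<s)
import Data.Nat.Properties as ℕP
import Data.Nat.Divisibility as ℕD
open import Data.Nat.Primality using (Prime; euclidsLemma; prime⇒nonZero)
open import Data.Integer as ℤ using (ℤ; +_; _*_; _+_; _-_; -_; ∣_∣)
import Data.Integer.Properties as ℤP
open import Data.Integer.DivMod using (_/_; _%_; n%d<d; a≡a%n+[a/n]*n)
open import Data.Integer.Divisibility using (_∣_)
open import Data.Integer.Divisibility.Signed as ℤD using (divides; ∣⇒∣ᵤ; ∣ᵤ⇒∣)
  renaming (_∣_ to _∣ˢ_)
open import Data.Integer.Tactic.RingSolver using (solve-∀)
open import Data.Fin as Fin using (Fin; toℕ; fromℕ<; punchOut)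
import Data.Fin.Properties as FinP
open import Data.Product using (Σ; ∃; _×_; _,_; proj₁; proj₂)
open import Data.Sum using (_⊎_; inj₁; inj₂)
open import Data.Bool using (true; false)
open import Relation.Nullary using (¬_; Dec; yes; no; contradiction)
open import Relation.Binary.PropositionalEquality
open import Relation.Binary.Definitions using (tri<; tri≈; tri>)

private
  variable
    d i j m n p t : ℕ
    α : ℤ

[n/d]*d≡n : ∀ n d .{{_ : ℤ.NonZero d}} → d ∣ˢ n → n / d * d ≡ n
[n/d]*d≡n n d d∣n with n % d | n%d<d n d | a≡a%n+[a/n]*n n d
... | zero  | _   | n≡ = sym (trans n≡ (ℤP.+-identityˡ _))
... | suc r | r<d | n≡ = contradiction r<d (ℕP.≤⇒≯ (ℕD.∣⇒≤ (∣⇒∣ᵤ d∣r)))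
  where
  remainder : ∀ r q → r + q - q ≡ r
  remainder = solve-∀
  d∣r : d ∣ˢ + suc r
  d∣r = subst (d ∣ˢ_) (trans (cong (_- n / d * d) n≡) (remainder (+ suc r) (n / d * d)))
          (ℤD.∣m∣n⇒∣m-n d∣n (ℤD.∣n⇒∣m*n (n / d) ℤD.∣-refl))

%≡0⇒∣ : ∀ a d .{{_ : ℤ.NonZero d}} → a % d ≡ 0 → d ∣ˢ a
%≡0⇒∣ a d eq = divides (a / d) (begin
  a                  ≡⟨ a≡a%n+[a/n]*n a d ⟩
  + (a % d) + a / d * d ≡⟨ cong (λ r → + r + a / d * d) eq ⟩
  + 0 + a / d * d    ≡⟨ ℤP.+-identityˡ _ ⟩
  a / d * d          ∎)
  where open ≡-Reasoning

%≡⇒∣- : ∀ a b d .{{_ : ℤ.NonZero d}} → a % d ≡ b % d → d ∣ˢ a - b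
%≡⇒∣- a b d eq = divides (a / d - b / d) (begin
  a - b                                         ≡⟨ cong₂ _-_ (a≡a%n+[a/n]*n a d) (a≡a%n+[a/n]*n b d) ⟩
  (+ (a % d) + a / d * d) - (+ (b % d) + b / d * d) ≡⟨ cong (λ r → (+ r + a / d * d) - (+ (b % d) + b / d * d)) eq ⟩
  (+ (b % d) + a / d * d) - (+ (b % d) + b / d * d) ≡⟨ cancel (+ (b % d)) (a / d) (b / d) d ⟩
  (a / d - b / d) * d                            ∎)
  where
  open ≡-Reasoning
  cancel : ∀ r u v d → (r + u * d) - (r + v * d) ≡ (u - v) * d
  cancel = solve-∀

prime-∣-* : Prime p → ∀ x y → + p ∣ˢ x * y → + p ∣ˢ x ⊎ + p ∣ˢ y
prime-∣-* {p} p-prime x y p∣xy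
  with euclidsLemma ∣ x ∣ ∣ y ∣ p-prime (subst (p ℕD.∣_) (ℤP.abs-* x y) (∣⇒∣ᵤ p∣xy))
... | inj₁ p∣x = inj₁ (∣ᵤ⇒∣ p∣x)
... | inj₂ p∣y = inj₂ (∣ᵤ⇒∣ p∣y)

odd-prime-∣-*2 : Prime p → 3 ≤ p → ∀ x → + p ∣ˢ x * + 2 → + p ∣ˢ x
odd-prime-∣-*2 p-prime 3≤p x p∣2x with prime-∣-* p-prime x (+ 2) p∣2x
... | inj₁ p∣x = p∣x
... | inj₂ p∣2 = contradiction (ℕD.∣⇒≤ (∣⇒∣ᵤ p∣2)) (ℕP.<⇒≱ 3≤p)

+-sub≡+∸ : j ≤ i → + i - + j ≡ + (i ∸ j)
+-sub≡+∸ {j} {i} j≤i = trans (ℤP.m-n≡m⊖n i j) (ℤP.⊖-≥ j≤i)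

∣-sub⇒≤∸ : j < i → + d ∣ˢ + i - + j → d ≤ i ∸ j
∣-sub⇒≤∸ {j} {i} j<i d∣i-j = ℕD.∣⇒≤ {{ℕ.>-nonZero (ℕP.m<n⇒0<n∸m j<i)}}
  (∣⇒∣ᵤ (subst (_ ∣ˢ_) (+-sub≡+∸ (ℕP.<⇒≤ j<i)) d∣i-j))

∣-sub⇒≡ : i < d → j < d → + d ∣ˢ + i - + j → i ≡ j
∣-sub⇒≡ {i} {d} {j} i<d j<d d∣i-j with ℕP.<-cmp i j
... | tri≈ _ i≡j _ = i≡j
... | tri> _ _ j<i = contradiction
  (ℕP.≤-<-trans (ℕP.≤-trans (∣-sub⇒≤∸ j<i d∣i-j) (ℕP.m∸n≤m i j)) i<d) (ℕP.n≮n d)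
... | tri< i<j _ _ = contradiction
  (ℕP.≤-<-trans (ℕP.≤-trans (∣-sub⇒≤∸ i<j d∣j-i) (ℕP.m∸n≤m j i)) j<d) (ℕP.n≮n d)
  where
  negate : ∀ x y → - (x - y) ≡ y - x
  negate = solve-∀
  d∣j-i : + d ∣ˢ + j - + i
  d∣j-i = subst (_ ∣ˢ_) (negate (+ i) (+ j)) (ℤD.∣m⇒∣-m d∣i-j)

∣-sub⇒endpoints : j < i → i ≤ d → + d ∣ˢ + i - + j → i ≡ d × j ≡ 0
∣-sub⇒endpoints {j} {i} {d} j<i i≤d d∣i-j = i≡d , j≡0
  where
  d≤i∸j : d ≤ i ∸ j
  d≤i∸j = ∣-sub⇒≤∸ j<i d∣i-j
  i≡d : i ≡ d
  i≡d = ℕP.≤-antisym i≤d (ℕP.≤-trans d≤i∸j (ℕP.m∸n≤m i j))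
  j≡0 : j ≡ 0
  j≡0 = ℕP.∸-cancelˡ-≡ (ℕP.<⇒≤ j<i) z≤n
          (ℕP.≤-antisym (ℕP.m∸n≤m i j) (ℕP.≤-trans i≤d d≤i∸j))

odd⇒≡2a+1 : ∀ x → ¬ + 2 ∣ x → ∃ λ a → x ≡ a * + 2 + + 1
odd⇒≡2a+1 x x-odd with x % + 2 | n%d<d x (+ 2) | a≡a%n+[a/n]*n x (+ 2)
... | zero        | _ | x≡ = contradiction (∣⇒∣ᵤ (divides (x / + 2) (trans x≡ (ℤP.+-identityˡ _)))) x-odd
... | suc zero    | _ | x≡ = x / + 2 , trans x≡ (ℤP.+-comm (+ 1) (x / + 2 * + 2))
... | suc (suc _) | s≤s (s≤s ()) | _

2∣n*[n+1] : ∀ n → + 2 ∣ˢ + n * (+ n + + 1)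
2∣n*[n+1] zero    = divides (+ 0) refl
2∣n*[n+1] (suc n) = subst (+ 2 ∣ˢ_) (step (+ n))
  (ℤD.∣m∣n⇒∣m+n (2∣n*[n+1] n) (ℤD.∣n⇒∣m*n (+ n + + 1) ℤD.∣-refl))
  where
  step : ∀ n → n * (n + + 1) + (n + + 1) * + 2 ≡ (+ 1 + n) * ((+ 1 + n) + + 1)
  step = solve-∀

2∣αn²+βn : ∀ α β → ¬ + 2 ∣ α → ¬ + 2 ∣ β → ∀ n → + 2 ∣ˢ α * + n * + n + β * + n
2∣αn²+βn α β α-odd β-odd n with odd⇒≡2a+1 α α-odd | odd⇒≡2a+1 β β-odd
... | a , refl | b , refl = subst (+ 2 ∣ˢ_) (sym (split a b (+ n)))
  (ℤD.∣m∣n⇒∣m+n (ℤD.∣n⇒∣m*n (a * + n * + n + b * + n) ℤD.∣-refl) (2∣n*[n+1] n))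
  where
  split : ∀ a b n → (a * + 2 + + 1) * n * n + (b * + 2 + + 1) * n ≡ (a * n * n + b * n) * + 2 + n * (n + + 1)
  split = solve-∀

linear-root : Prime p → ¬ + p ∣ˢ α → ∀ β → ∃ λ x → x < p × + p ∣ˢ α * + x + β
linear-root {zero} p-prime = contradiction refl (ℕ.≢-nonZero⁻¹ 0 {{prime⇒nonZero p-prime}})
linear-root {suc p′} {α} p-prime p∤α β = root (FinP.any? (λ x → Fin.zero Fin.≟ residue x))
  where
  value : Fin (suc p′) → ℤ
  value x = α * + toℕ x + β

  residue : Fin (suc p′) → Fin (suc p′)
  residue x = fromℕ< (n%d<d (value x) (+ suc p′))

  toℕ-residue : ∀ x → toℕ (residue x) ≡ value x % + suc p′
  toℕ-residue x = FinP.toℕ-fromℕ< (n%d<d (value x) (+ suc p′))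

  residue-injective : ∀ {x y} → residue x ≡ residue y → x ≡ y
  residue-injective {x} {y} eq = FinP.toℕ-injective (∣-sub⇒≡ (FinP.toℕ<n x) (FinP.toℕ<n y) p∣x-y)
    where
    difference : ∀ a b x y → (a * x + b) - (a * y + b) ≡ a * (x - y)
    difference = solve-∀
    p∣x-y : + suc p′ ∣ˢ + toℕ x - + toℕ y
    p∣x-y with prime-∣-* p-prime α (+ toℕ x - + toℕ y) (subst (_ ∣ˢ_) (difference α β (+ toℕ x) (+ toℕ y))
                 (%≡⇒∣- (value x) (value y) _ (trans (sym (toℕ-residue x)) (trans (cong toℕ eq) (toℕ-residue y)))))
    ... | inj₁ p∣α   = contradiction p∣α p∤α
    ... | inj₂ p∣x-y = p∣x-y

  -- Pigeonhole: without a zero residue, the injective residue map would embed Fin p into Fin (p − 1).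
  root : Dec (∃ λ x → Fin.zero ≡ residue x) → ∃ λ x → x < suc p′ × + suc p′ ∣ˢ α * + x + β
  root (yes (x , 0≡r)) = toℕ x , FinP.toℕ<n x , %≡0⇒∣ (value x) _ (trans (sym (toℕ-residue x)) (cong toℕ (sym 0≡r)))
  root (no no-root) = contradiction (FinP.injective⇒≤ avoid-injective) ℕP.1+n≰n
    where
    avoid : Fin (suc p′) → Fin p′
    avoid x = punchOut (λ 0≡r → no-root (x , 0≡r))
    avoid-injective : ∀ {x y} → avoid x ≡ avoid y → x ≡ y
    avoid-injective {x} {y} eq = residue-injective
      (FinP.punchOut-injective (λ 0≡r → no-root (x , 0≡r)) (λ 0≡r → no-root (y , 0≡r)) eq)

collision⇒¬IsDiscriminator : ∀ s → i < n → j < n → i ≢ j → + m ∣ s i - s j → ¬ IsDiscriminator s n m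
collision⇒¬IsDiscriminator _ i<n j<n i≢j m∣sᵢ-sⱼ (_ , discriminates , _) =
  discriminates _ _ i<n j<n i≢j m∣sᵢ-sⱼ

smaller⇒¬IsDiscriminator : ∀ s → 0 < m → m < t → Discriminates s n m → ¬ IsDiscriminator s n t
smaller⇒¬IsDiscriminator _ 0<m m<t discriminates (_ , _ , least) = least _ 0<m m<t discriminates

Discriminates-by-< : ∀ s → (∀ {i j} → j < i → i < n → ¬ + m ∣ s i - s j) → Discriminates s n m
Discriminates-by-< {n} {m} s separated i j i<n j<n i≢j with ℕP.<-cmp i j
... | tri< i<j _ _ = λ m∣sᵢ-sⱼ → separated i<j j<n (flip m∣sᵢ-sⱼ)
  where
  flip : + m ∣ s i - s j → + m ∣ s j - s i
  flip = subst (m ℕD.∣_) (ℤP.∣i-j∣≡∣j-i∣ (s i) (s j))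
... | tri≈ _ i≡j _ = contradiction i≡j i≢j
... | tri> _ _ j<i = separated j<i i<n

ceilLogGo-stop : ∀ p n k f → n ≤ p ^ k → ceilLogGo p n k (suc f) ≡ k
ceilLogGo-stop p n k f n≤pᵏ with n ℕ.≤ᵇ p ^ k | ℕP.≤⇒≤ᵇ n≤pᵏ
... | true | _ = refl

ceilLogGo-skip : ∀ p n k f → p ^ k < n → ceilLogGo p n k (suc f) ≡ ceilLogGo p n (suc k) f
ceilLogGo-skip p n k f pᵏ<n with n ℕ.≤ᵇ p ^ k | ℕP.≤ᵇ⇒≤ n (p ^ k)
... | true  | n≤pᵏ = contradiction (n≤pᵏ _) (ℕP.<⇒≱ pᵏ<n)
... | false | _    = refl

p^⌈log⌉≡p : 1 < n → n ≤ p → p ^ (⌈log p ⌉ n) ≡ p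
p^⌈log⌉≡p {suc zero} (s≤s ())
p^⌈log⌉≡p {suc (suc f)} {p} 1<n n≤p = begin
  p ^ ceilLogGo p (2 ℕ.+ f) 0 (2 ℕ.+ f) ≡⟨ cong (p ^_) (ceilLogGo-skip p (2 ℕ.+ f) 0 (1 ℕ.+ f) 1<n) ⟩
  p ^ ceilLogGo p (2 ℕ.+ f) 1 (1 ℕ.+ f) ≡⟨ cong (p ^_) (ceilLogGo-stop p (2 ℕ.+ f) 1 f (subst (_ ≤_) (sym p¹≡p) n≤p)) ⟩
  p ^ 1                                 ≡⟨ p¹≡p ⟩
  p                                     ∎
  where
  open ≡-Reasoning
  p¹≡p : p ^ 1 ≡ p
  p¹≡p = ℕP.^-identityʳ p

p^⌈log⌉≡p² : 1 < n → p < n → n ≤ p ℕ.* p → p ^ (⌈log p ⌉ n) ≡ p ℕ.* p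
p^⌈log⌉≡p² {suc zero} (s≤s ())
p^⌈log⌉≡p² {suc (suc f)} {p} 1<n p<n n≤p² = begin
  p ^ ceilLogGo p (2 ℕ.+ f) 0 (2 ℕ.+ f) ≡⟨ cong (p ^_) (ceilLogGo-skip p (2 ℕ.+ f) 0 (1 ℕ.+ f) 1<n) ⟩
  p ^ ceilLogGo p (2 ℕ.+ f) 1 (1 ℕ.+ f) ≡⟨ cong (p ^_) (ceilLogGo-skip p (2 ℕ.+ f) 1 f (subst (_< _) (sym (ℕP.^-identityʳ p)) p<n)) ⟩
  p ^ ceilLogGo p (2 ℕ.+ f) 2 f         ≡⟨ cong (p ^_) (stop f) ⟩
  p ^ 2                                 ≡⟨ p²≡p*p ⟩
  p ℕ.* p                               ∎
  where
  open ≡-Reasoning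
  p²≡p*p : p ^ 2 ≡ p ℕ.* p
  p²≡p*p = cong (p ℕ.*_) (ℕP.*-identityʳ p)
  stop : ∀ f′ → ceilLogGo p (2 ℕ.+ f) 2 f′ ≡ 2
  stop zero     = refl
  stop (suc f′) = ceilLogGo-stop p (2 ℕ.+ f) 2 f′ (subst (2 ℕ.+ f ≤_) (sym p²≡p*p) n≤p²)

module OddQuadratic (α β γ : ℤ) (α-odd : ¬ + 2 ∣ α) (β-odd : ¬ + 2 ∣ β) where

  q : ℕ → ℤ
  q = quadSeq α β γ

  quadSeq-*2 : ∀ n → q n * + 2 ≡ α * + n * + n + β * + n + γ * + 2
  quadSeq-*2 n = begin
    (Y / + 2 + γ) * + 2         ≡⟨ ℤP.*-distribʳ-+ (+ 2) (Y / + 2) γ ⟩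
    Y / + 2 * + 2 + γ * + 2     ≡⟨ cong (_+ γ * + 2) ([n/d]*d≡n Y (+ 2) (2∣αn²+βn α β α-odd β-odd n)) ⟩
    Y + γ * + 2                 ∎
    where
    open ≡-Reasoning
    Y : ℤ
    Y = α * + n * + n + β * + n

  quadSeq-diff : ∀ i j → (q i - q j) * + 2 ≡ (+ i - + j) * (α * (+ i + + j) + β)
  quadSeq-diff i j = begin
    (q i - q j) * + 2         ≡⟨ distrib (q i) (q j) ⟩
    q i * + 2 - q j * + 2     ≡⟨ cong₂ _-_ (quadSeq-*2 i) (quadSeq-*2 j) ⟩
    (α * + i * + i + β * + i + γ * + 2) - (α * + j * + j + β * + j + γ * + 2)
                              ≡⟨ factor α β γ (+ i) (+ j) ⟩
    (+ i - + j) * (α * (+ i + + j) + β) ∎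
    where
    open ≡-Reasoning
    distrib : ∀ x y → (x - y) * + 2 ≡ x * + 2 - y * + 2
    distrib = solve-∀
    factor : ∀ a b c x y → (a * x * x + b * x + c * + 2) - (a * y * y + b * y + c * + 2)
                           ≡ (x - y) * (a * (x + y) + b)
    factor = solve-∀

  n-1∣q₁-q₀⇒n[n-1]∤qₙ-q₀ : ∀ n → 2 ≤ n → + (n ∸ 1) ∣ˢ q 1 - q 0 → ¬ + (n ℕ.* (n ∸ 1)) ∣ˢ q n - q 0
  n-1∣q₁-q₀⇒n[n-1]∤qₙ-q₀ (suc zero) (s≤s ())
  n-1∣q₁-q₀⇒n[n-1]∤qₙ-q₀ (suc m@(suc _)) _ (divides l q₁-q₀≡) (divides c qₙ-q₀≡) =
    α-odd (∣⇒∣ᵤ (divides (c - l) α≡))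
    where
    open ≡-Reasoning
    N : ℤ
    N = + suc m * + m
    identity : ∀ a b M → a * ((+ 1 + M) * M)
                       ≡ ((+ 1 + M) - + 0) * (a * ((+ 1 + M) + + 0) + b) - (+ 1 - + 0) * (a * (+ 1 + + 0) + b) * (+ 1 + M)
    identity = solve-∀
    regroup : ∀ c l M → c * ((+ 1 + M) * M) * + 2 - l * M * + 2 * (+ 1 + M) ≡ (c - l) * + 2 * ((+ 1 + M) * M)
    regroup = solve-∀
    -- 2(qₙ − q₀) − 2n(q₁ − q₀) = α n(n − 1), and n(n − 1) divides both terms on the left.
    α≡ : α ≡ (c - l) * + 2
    α≡ = ℤP.*-cancelʳ-≡ α ((c - l) * + 2) N (begin
      α * N
        ≡⟨ identity α β (+ m) ⟩
      (+ suc m - + 0) * (α * (+ suc m + + 0) + β) - (+ 1 - + 0) * (α * (+ 1 + + 0) + β) * + suc m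
        ≡⟨ sym (cong₂ _-_ (quadSeq-diff (suc m) 0) (cong (_* + suc m) (quadSeq-diff 1 0))) ⟩
      (q (suc m) - q 0) * + 2 - (q 1 - q 0) * + 2 * + suc m
        ≡⟨ cong₂ (λ u v → u * + 2 - v * + 2 * + suc m) (trans qₙ-q₀≡ (cong (c *_) (ℤP.pos-* (suc m) m))) q₁-q₀≡ ⟩
      c * N * + 2 - l * + m * + 2 * + suc m
        ≡⟨ regroup c l (+ m) ⟩
      (c - l) * + 2 * N ∎)

  module ModOddPrime {p : ℕ} (p-prime : Prime p) (3≤p : 3 ≤ p) where

    D[_]≢_ : ℕ → ℕ → Set
    D[ n ]≢ t = ¬ IsDiscriminator q n t

    1<p : 1 < p
    1<p = ℕP.≤-trans (s≤s (s≤s z≤n)) 3≤p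
    0<p : 0 < p
    0<p = ℕP.<-trans z<s 1<p
    1<p-1 : 1 < p ∸ 1
    1<p-1 = ℕP.∸-monoˡ-≤ 1 3≤p
    0<p-1 : 0 < p ∸ 1
    0<p-1 = ℕP.<-trans z<s 1<p-1
    p-1<p : p ∸ 1 < p
    p-1<p = ℕP.∸-monoʳ-< z<s (ℕP.<⇒≤ 1<p)

    p∣factor⇒p∣q-diff : ∀ i j → + p ∣ˢ α * (+ i + + j) + β → + p ∣ q i - q j
    p∣factor⇒p∣q-diff i j p∣f = ∣⇒∣ᵤ (odd-prime-∣-*2 p-prime 3≤p (q i - q j)
      (subst (+ p ∣ˢ_) (sym (quadSeq-diff i j)) (ℤD.∣n⇒∣m*n (+ i - + j) p∣f)))

    p∤α⇒D[p]≢p : ¬ + p ∣ˢ α → D[ p ]≢ p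
    p∤α⇒D[p]≢p p∤α with linear-root p-prime p∤α β
    ... | zero , _ , p∣α0+β =
      collision⇒¬IsDiscriminator q 1<p p-1<p (ℕP.<⇒≢ 1<p-1) (p∣factor⇒p∣q-diff 1 (p ∸ 1) p∣f)
      where
      α0+β≡β : ∀ a b → a * + 0 + b ≡ b
      α0+β≡β = solve-∀
      p∣f : + p ∣ˢ α * (+ 1 + + (p ∸ 1)) + β
      p∣f = subst (λ x → + p ∣ˢ α * + x + β) (sym (ℕP.m+[n∸m]≡n (ℕP.<⇒≤ 1<p)))
              (ℤD.∣m∣n⇒∣m+n (ℤD.∣n⇒∣m*n α ℤD.∣-refl) (subst (+ p ∣ˢ_) (α0+β≡β α β) p∣α0+β))
    ... | suc x , x<p , p∣αx+β =
      collision⇒¬IsDiscriminator q x<p 0<p (λ ())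
        (p∣factor⇒p∣q-diff (suc x) 0 (subst (λ y → + p ∣ˢ α * y + β) (sym (ℤP.+-identityʳ _)) p∣αx+β))

    p∣α⇒p∣β⇒D[2]≢p : + p ∣ˢ α → + p ∣ˢ β → D[ 2 ]≢ p
    p∣α⇒p∣β⇒D[2]≢p p∣α p∣β = collision⇒¬IsDiscriminator q (s≤s (s≤s z≤n)) (s≤s z≤n) (λ ())
      (p∣factor⇒p∣q-diff 1 0 (ℤD.∣m∣n⇒∣m+n (ℤD.∣m⇒∣m*n (+ 1 + + 0) p∣α) p∣β))

    p-1∤q₁-q₀⇒D[2]≢p : ¬ + (p ∸ 1) ∣ q 1 - q 0 → D[ 2 ]≢ p
    p-1∤q₁-q₀⇒D[2]≢p p-1∤q₁-q₀ = smaller⇒¬IsDiscriminator q 0<p-1 p-1<p (Discriminates-by-< q separated)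
      where
      separated : ∀ {i j} → j < i → i < 2 → ¬ + (p ∸ 1) ∣ q i - q j
      separated {suc zero}    {zero} _ _ = p-1∤q₁-q₀
      separated {zero} ()
      separated {suc zero} {suc _} (s≤s ())
      separated {suc (suc _)} _ (s≤s (s≤s ()))

    p∣q-diff⇒endpoints : ∀ {i j} → + p ∣ˢ α → ¬ + p ∣ˢ β → j < i → i ≤ p → + p ∣ˢ q i - q j → i ≡ p × j ≡ 0
    p∣q-diff⇒endpoints {i} {j} p∣α p∤β j<i i≤p p∣qᵢ-qⱼ =
      endpoints (prime-∣-* p-prime (+ i - + j) (α * (+ i + + j) + β) p∣product)
      where
      p∣product : + p ∣ˢ (+ i - + j) * (α * (+ i + + j) + β)
      p∣product = subst (+ p ∣ˢ_) (quadSeq-diff i j) (ℤD.∣m⇒∣m*n (+ 2) p∣qᵢ-qⱼ)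
      endpoints : + p ∣ˢ + i - + j ⊎ + p ∣ˢ α * (+ i + + j) + β → i ≡ p × j ≡ 0
      endpoints (inj₁ p∣i-j) = ∣-sub⇒endpoints j<i i≤p p∣i-j
      endpoints (inj₂ p∣f)   = contradiction (ℤD.∣m+n∣m⇒∣n p∣f (ℤD.∣m⇒∣m*n (+ i + + j) p∣α)) p∤β

    D[p+1]≢p² : + p ∣ˢ α → ¬ + p ∣ˢ β → + (p ∸ 1) ∣ q 1 - q 0 → D[ suc p ]≢ (p ℕ.* p)
    D[p+1]≢p² p∣α p∤β p-1∣q₁-q₀ =
      smaller⇒¬IsDiscriminator q (ℕP.*-mono-< {0} 0<p 0<p-1)
        (ℕP.*-monoʳ-< p {{prime⇒nonZero p-prime}} p-1<p) (Discriminates-by-< q separated)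
      where
      separated : ∀ {i j} → j < i → i < suc p → ¬ + (p ℕ.* (p ∸ 1)) ∣ q i - q j
      separated {i} {j} j<i (s≤s i≤p) p[p-1]∣qᵢ-qⱼ =
        n-1∣q₁-q₀⇒n[n-1]∤qₙ-q₀ p 1<p (∣ᵤ⇒∣ p-1∣q₁-q₀)
          (subst₂ (λ i j → + (p ℕ.* (p ∸ 1)) ∣ˢ q i - q j) (proj₁ ends) (proj₂ ends) p[p-1]∣ˢqᵢ-qⱼ)
        where
        p[p-1]∣ˢqᵢ-qⱼ : + (p ℕ.* (p ∸ 1)) ∣ˢ q i - q j
        p[p-1]∣ˢqᵢ-qⱼ = ∣ᵤ⇒∣ p[p-1]∣qᵢ-qⱼ
        ends : i ≡ p × j ≡ 0
        ends = p∣q-diff⇒endpoints p∣α p∤β j<i i≤p (ℤD.∣-trans (∣ᵤ⇒∣ (ℕD.m∣m*n (p ∸ 1))) p[p-1]∣ˢqᵢ-qⱼ)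

-- The hypothesis (1) ∨ (2) ∨ (3) is not needed: the case analysis covers all odd α′, β′.
lemma4 : (p : ℕ) → Prime p → 3 ≤ p → (α β γ : ℤ) →
    ¬ ((+ 2) ∣ α) → ¬ ((+ 2) ∣ β) →
    (¬ ((+ p) ∣ α)
    ⊎ ((+ p) ∣ β)
    ⊎ (Σ ℕ λ k → Σ ℤ λ c → (α ≡ (+ (p ^ k)) * c) × ¬ ((+ p) ∣ c) × ¬ (c ∣ β))) →
    Σ ℕ λ n → (0 < n) × ¬ IsDiscriminator (quadSeq α β γ) n (p ^ (⌈log p ⌉ n))
lemma4 p p-prime 3≤p α β γ α-odd β-odd _ =
  cases (+ p ℤD.∣? α) (+ p ℤD.∣? β) ((p ∸ 1) ℕD.∣? ∣ q 1 - q 0 ∣)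
  where
  open OddQuadratic α β γ α-odd β-odd
  open ModOddPrime p-prime 3≤p
  instance
    _ = prime⇒nonZero p-prime
  1<2 : 1 < 2
  1<2 = s≤s (s≤s z≤n)

  Witness : Set
  Witness = Σ ℕ λ n → (0 < n) × ¬ IsDiscriminator q n (p ^ (⌈log p ⌉ n))

  witness : ∀ {n t} → 0 < n → p ^ (⌈log p ⌉ n) ≡ t → D[ n ]≢ t → Witness
  witness {n} 0<n pᵏ≡t D[n]≢t = n , 0<n , subst D[ n ]≢_ (sym pᵏ≡t) D[n]≢t

  cases : Dec (+ p ∣ˢ α) → Dec (+ p ∣ˢ β) → Dec (+ (p ∸ 1) ∣ q 1 - q 0) → Witness
  cases (no p∤α)  _          _    = witness 0<p (p^⌈log⌉≡p 1<p ℕP.≤-refl) (p∤α⇒D[p]≢p p∤α)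
  cases (yes p∣α) (yes p∣β)  _    = witness z<s (p^⌈log⌉≡p 1<2 1<p) (p∣α⇒p∣β⇒D[2]≢p p∣α p∣β)
  cases (yes _)   (no _)    (no p-1∤q₁-q₀) =
    witness z<s (p^⌈log⌉≡p 1<2 1<p) (p-1∤q₁-q₀⇒D[2]≢p p-1∤q₁-q₀)
  cases (yes p∣α) (no p∤β)  (yes p-1∣q₁-q₀) =
    witness z<s (p^⌈log⌉≡p² (s≤s 0<p) (ℕP.n<1+n p) (ℕP.m<m*n p p 1<p)) (D[p+1]≢p² p∣α p∤β p-1∣q₁-q₀)
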